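{- Let $n\geq 4$ and let $\Sigma_n$ be the $n$-th Schreier graph of the Basilica group. The number of cycles labeled by $a$ in $\Sigma_n$ is $\frac{2^{n-1}+2}{3}$ if $n$ is odd and $\frac{2^{n-1}+1}{3}$ if $n$ is even; the number of cycles labeled by $b$ is $\frac{2^n+1}{3}$ if $n$ is odd and $\frac{2^n+2}{3}$ if $n$ is even. The total number of cycles of length $\geq 2$ is $2^{n-1}+1$, and the total number of edges (without loops) is $3\cdot 2^{n-1}$.
   Context: Automorphisms of the rooted binary tree (vertices = finite words over $\{0,1\}$) are written $g=\tau(g_0,g_1)$, meaning $g(xw)=\tau(x)g_x(w)$. The Basilica group is generated by $a$ and $b$ with $a(0w)=0b(w)$, $a(1w)=1w$, $b(0w)=1a(w)$, $b(1w)=0w$. Its $n$-th Schreier graph $\Sigma_n$ has vertex set the $2^n$ words of length $n$ over $\{0,1\}$; for each $s\in\{a,b\}$ and each vertex $u$ with $s(u)\neq u$ there is one edge joining $u$ and $s(u)$, labeled $s$; loops are erased. Each orbit of $\langle s\rangle$ of size $k\geq2$ gives a cycle of length $k$ labeled by $s$ (a double edge when $k=2$); these are the cycles labeled by $s$. -}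

module Defs where

open import Data.Bool using (Bool; true; false; if_then_else_; _∧_; not)
open import Data.Nat using (ℕ; zero; suc; _+_; _*_; _^_; _≤ᵇ_)
open import Data.Vec using (Vec; []; _∷_)
open import Data.Vec.Properties using (≡-dec)
import Data.Bool.Properties as BP
open import Data.List using (List; []; _∷_; map; _++_; length; filterᵇ; upTo)
open import Data.Bool.ListAction using (and)
open import Relation.Nullary.Decidable using (⌊_⌋)

-- Vertices of the n-th level: words of length n over {0,1}; 0 = false, 1 = true.
Word : ℕ → Set
Word n = Vec Bool n

mutual
  actA : ∀ {n} → Word n → Word n
  actA []            = []
  actA (false ∷ w)   = false ∷ actB w
  actA (true  ∷ w)   = true ∷ w

  actB : ∀ {n} → Word n → Word n
  actB []            = []
  actB (false ∷ w)   = true ∷ actA w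
  actB (true  ∷ w)   = false ∷ w

allWords : (n : ℕ) → List (Word n)
allWords zero    = [] ∷ []
allWords (suc n) = map (false ∷_) (allWords n) ++ map (true ∷_) (allWords n)

_==_ : ∀ {n} → Word n → Word n → Bool
u == v = ⌊ ≡-dec BP._≟_ u v ⌋

iter : ∀ {n} → (Word n → Word n) → ℕ → Word n → Word n
iter s zero    u = u
iter s (suc k) u = s (iter s k u)

-- The orbit of u under ⟨s⟩ (s a permutation of the 2^n words): s^k(u), 0 ≤ k < 2^n.
orbit : ∀ {n} → (Word n → Word n) → Word n → List (Word n)
orbit {n} s u = map (λ k → iter s k u) (upTo (2 ^ n))

-- Binary value of a word (injective), used to choose one representative per orbit.
val : ∀ {n} → Word n → ℕ
val []      = 0
val (x ∷ w) = (if x then 1 else 0) + 2 * val w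

isRep : ∀ {n} → (Word n → Word n) → Word n → Bool
isRep s u = and (map (λ v → val u ≤ᵇ val v) (orbit s u))

moved : ∀ {n} → (Word n → Word n) → Word n → Bool
moved s u = not (s u == u)

-- Number of cycles of Σ_n labeled by s = number of ⟨s⟩-orbits of size ≥ 2
-- (counted via their minimal representatives; an orbit has size ≥ 2 iff its elements are moved).
cyclesLabeled : (n : ℕ) → (Word n → Word n) → ℕ
cyclesLabeled n s = length (filterᵇ (λ u → isRep s u ∧ moved s u) (allWords n))

-- Number of edges of Σ_n labeled by s: one edge {u, s(u)} for each vertex u with s(u) ≠ u.
edgesLabeled : (n : ℕ) → (Word n → Word n) → ℕ
edgesLabeled n s = length (filterᵇ (moved s) (allWords n))

cyclesA cyclesB totalCycles totalEdges : ℕ → ℕ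
cyclesA n     = cyclesLabeled n actA
cyclesB n     = cyclesLabeled n actB
totalCycles n = cyclesA n + cyclesB n
totalEdges n  = edgesLabeled n actA + edgesLabeled n actB

module Submission where

-- Orbits are counted through their minimal words for the binary value, and val (0 ∷ w) = 2 * val w.
-- Since a = (b, 1), the word 1w is fixed by a while the ⟨a⟩-orbit of 0w is 0 followed by the
-- ⟨b⟩-orbit of w; since b = σ(a, 1), so that b² = (a, a), the ⟨b⟩-orbit of 0w is the ⟨a⟩-orbit of w
-- with alternating first letters and contains no minimal word starting with 1.  Hence the orbit
-- counts satisfy O_a(n+1) = O_b(n) + 2^n and O_b(n+1) = O_a(n), so O_a(n+2) = O_a(n) + 2^(n+1),
-- which gives 3 O_a(n) = 2^(n+1) + 1 + (n mod 2) and O_a(n) + O_a(n+1) = 2^(n+1) + 1.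
-- Finally b moves every word and a moves exactly those starting with 0, so the cycles labeled b
-- on level n+1 are all ⟨b⟩-orbits, O_b(n+1) = O_a(n), and those labeled a on level n+2 are the
-- orbits through words 0w, O_b(n+1) = O_a(n).

open import Defs
open import Data.Nat using (ℕ; _+_; _*_; _^_; _≤_; _∸_; _%_)
open import Data.Product using (_×_)
open import Relation.Binary.PropositionalEquality using (_≡_)

open import Data.Bool using (Bool; true; false; T; _∧_; not)
open import Data.Bool.ListAction using (all)
open import Data.Bool.Properties using (T-∧; ∧-identityʳ; ∧-zeroʳ)
open import Data.Empty using (⊥-elim)
open import Data.List using (List; []; _∷_; map; _++_; length; filterᵇ)
open import Data.List.Properties using (length-++; length-map; filter-++)
open import Data.List.Relation.Unary.All using (All; []; _∷_)
open import Data.List.Relation.Unary.All.Properties using (map⁺; map⁻; applyUpTo⁺₂; applyUpTo⁻)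
open import Data.Nat using (zero; suc; s≤s; NonZero)
open import Data.Nat.DivMod using (_/_; m≡m%n+[m/n]*n; m%n<n)
open import Data.Nat.Properties
open import Data.Nat.Solver using (module +-*-Solver)
open import Data.Product using (_,_; ∃-syntax)
open import Data.Sum using (_⊎_; inj₁; inj₂)
open import Data.Vec using ([]; _∷_; tail)
open import Data.Vec.Properties using (≡-dec)
open import Function using (_∘_; id; _⇔_; mk⇔; Equivalence)
open import Relation.Binary.PropositionalEquality
  using (_≢_; refl; sym; trans; cong; cong₂; subst; module ≡-Reasoning)
open import Relation.Nullary using (¬_; yes; no)
import Data.Bool.Properties as Bool

open Equivalence using (to; from)
open +-*-Solver using (solve; _:=_; _:+_; _:*_; con)

count : ∀ {A : Set} → (A → Bool) → List A → ℕ
count p xs = length (filterᵇ p xs)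

count-++ : ∀ {A : Set} (p : A → Bool) xs ys → count p (xs ++ ys) ≡ count p xs + count p ys
count-++ p xs ys = trans (cong length (filter-++ (Bool.T? ∘ p) xs ys)) (length-++ (filterᵇ p xs))

count-map : ∀ {A B : Set} (p : B → Bool) (f : A → B) xs → count p (map f xs) ≡ count (p ∘ f) xs
count-map p f []       = refl
count-map p f (x ∷ xs) with p (f x)
... | true  = cong suc (count-map p f xs)
... | false = count-map p f xs

count-cong : ∀ {A : Set} {p q : A → Bool} → (∀ x → p x ≡ q x) → ∀ xs → count p xs ≡ count q xs
count-cong           p≗q []       = refl
count-cong {q = q} p≗q (x ∷ xs) rewrite p≗q x with q x
... | true  = cong suc (count-cong p≗q xs)
... | false = count-cong p≗q xs

count-true : ∀ {A : Set} {p : A → Bool} → (∀ x → p x ≡ true) → ∀ xs → count p xs ≡ length xs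
count-true p≡true []       = refl
count-true p≡true (x ∷ xs) rewrite p≡true x = cong suc (count-true p≡true xs)

count-false : ∀ {A : Set} {p : A → Bool} → (∀ x → p x ≡ false) → ∀ xs → count p xs ≡ 0
count-false p≡false []       = refl
count-false p≡false (x ∷ xs) rewrite p≡false x = count-false p≡false xs

length-allWords : ∀ n → length (allWords n) ≡ 2 ^ n
length-allWords zero    = refl
length-allWords (suc n) = begin
  length (map (false ∷_) ws ++ map (true ∷_) ws)       ≡⟨ length-++ (map (false ∷_) ws) ⟩
  length (map (false ∷_) ws) + length (map (true ∷_) ws) ≡⟨ cong₂ _+_ (length-map _ ws) (length-map _ ws) ⟩
  length ws + length ws                                   ≡⟨ cong₂ _+_ (length-allWords n) (length-allWords n) ⟩
  2 ^ n + 2 ^ n                                           ≡⟨ cong (2 ^ n +_) (sym (+-identityʳ (2 ^ n))) ⟩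
  2 ^ suc n                                               ∎
  where open ≡-Reasoning
        ws = allWords n

count-allWords-suc : ∀ n (p : Word (suc n) → Bool) →
  count p (allWords (suc n)) ≡ count (p ∘ (false ∷_)) (allWords n) + count (p ∘ (true ∷_)) (allWords n)
count-allWords-suc n p = begin
  count p (map (false ∷_) ws ++ map (true ∷_) ws)         ≡⟨ count-++ p (map (false ∷_) ws) _ ⟩
  count p (map (false ∷_) ws) + count p (map (true ∷_) ws) ≡⟨ cong₂ _+_ (count-map p _ ws) (count-map p _ ws) ⟩
  count (p ∘ (false ∷_)) ws + count (p ∘ (true ∷_)) ws    ∎
  where open ≡-Reasoning
        ws = allWords n

==-refl : ∀ {n} (u : Word n) → (u == u) ≡ true
==-refl u with ≡-dec Bool._≟_ u u
... | yes _   = refl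
... | no u≢u = ⊥-elim (u≢u refl)

==-≢ : ∀ {n} {u v : Word n} → u ≢ v → (u == v) ≡ false
==-≢ {u = u} {v} u≢v with ≡-dec Bool._≟_ u v
... | yes u≡v = ⊥-elim (u≢v u≡v)
... | no _    = refl

moved-≢ : ∀ {n} {s : Word n → Word n} {u} → s u ≢ u → moved s u ≡ true
moved-≢ su≢u = cong not (==-≢ su≢u)

actB-moves : ∀ {n} (u : Word (suc n)) → actB u ≢ u
actB-moves (false ∷ w) ()
actB-moves (true ∷ w)  ()

movedB : ∀ {n} (u : Word (suc n)) → moved actB u ≡ true
movedB u = moved-≢ {s = actB} (actB-moves u)

movedA-0 : ∀ {n} (w : Word (suc n)) → moved actA (false ∷ w) ≡ true
movedA-0 w = moved-≢ {s = actA} (actB-moves w ∘ cong tail)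

movedA-1 : ∀ {n} (w : Word n) → moved actA (true ∷ w) ≡ false
movedA-1 w = cong not (==-refl (true ∷ w))

iter-+ : ∀ {n} (s : Word n → Word n) k m u → iter s (k + m) u ≡ iter s k (iter s m u)
iter-+ s zero    m u = refl
iter-+ s (suc k) m u = cong s (iter-+ s k m u)

Periodic : ∀ {n} → (Word n → Word n) → ℕ → Set
Periodic s P = ∀ u → iter s P u ≡ u

iter-*-period : ∀ {n} {s : Word n → Word n} {P} → Periodic s P → ∀ q u → iter s (q * P) u ≡ u
iter-*-period             per zero    u = refl
iter-*-period {s = s} {P} per (suc q) u = begin
  iter s (P + q * P) u        ≡⟨ iter-+ s P (q * P) u ⟩
  iter s P (iter s (q * P) u) ≡⟨ cong (iter s P) (iter-*-period per q u) ⟩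
  iter s P u                  ≡⟨ per u ⟩
  u                           ∎
  where open ≡-Reasoning

iter-%-period : ∀ {n} {s : Word n → Word n} {P} .{{_ : NonZero P}} → Periodic s P →
  ∀ k u → iter s (k % P) u ≡ iter s k u
iter-%-period {s = s} {P} per k u = begin
  iter s (k % P) u                          ≡⟨ cong (iter s (k % P)) (iter-*-period per (k / P) u) ⟨
  iter s (k % P) (iter s (k / P * P) u)     ≡⟨ iter-+ s (k % P) (k / P * P) u ⟨
  iter s (k % P + k / P * P) u              ≡⟨ cong (λ j → iter s j u) (m≡m%n+[m/n]*n k P) ⟨
  iter s k u                                ∎
  where open ≡-Reasoning

Word0-periodic : (s : Word 0 → Word 0) → Periodic s 1
Word0-periodic s [] with s []
... | [] = refl

iterA-1 : ∀ {n} k (w : Word n) → iter actA k (true ∷ w) ≡ true ∷ w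
iterA-1 zero    w = refl
iterA-1 (suc k) w rewrite iterA-1 k w = refl

iterA-0 : ∀ {n} k (w : Word n) → iter actA k (false ∷ w) ≡ false ∷ iter actB k w
iterA-0 zero    w = refl
iterA-0 (suc k) w rewrite iterA-0 k w = refl

iterB-even : ∀ {n} k x (w : Word n) → iter actB (k + k) (x ∷ w) ≡ x ∷ iter actA k w
iterB-even zero    x     w = refl
iterB-even (suc k) x     w rewrite +-suc k k | iterB-even k x w with x
... | false = refl
... | true  = refl

iterB-odd : ∀ {n} k (w : Word n) → iter actB (suc (k + k)) (false ∷ w) ≡ true ∷ iter actA (suc k) w
iterB-odd k w rewrite iterB-even k false w = refl

mutual
  actA-period : ∀ n → Periodic (actA {n}) (2 ^ n)
  actA-period zero              = Word0-periodic actA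
  actA-period (suc n) (true ∷ w)  = iterA-1 (2 ^ suc n) w
  actA-period (suc n) (false ∷ w) rewrite iterA-0 (2 ^ suc n) w =
    cong (false ∷_) (iter-*-period {P = 2 ^ n} (actB-period n) 2 w)

  actB-period : ∀ n → Periodic (actB {n}) (2 ^ n)
  actB-period zero              = Word0-periodic actB
  actB-period (suc n) (x ∷ w) rewrite +-identityʳ (2 ^ n) | iterB-even (2 ^ n) x w =
    cong (x ∷_) (actA-period n w)

T-all⁻ : ∀ {A : Set} (p : A → Bool) xs → T (all p xs) → All (T ∘ p) xs
T-all⁻ p []       _ = []
T-all⁻ p (x ∷ xs) t = let px , pxs = to T-∧ t in px ∷ T-all⁻ p xs pxs

T-all⁺ : ∀ {A : Set} (p : A → Bool) {xs} → All (T ∘ p) xs → T (all p xs)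
T-all⁺ p []         = _
T-all⁺ p (px ∷ pxs) = from T-∧ (px , T-all⁺ p pxs)

T-injective : ∀ {b c} → (T b ⇔ T c) → b ≡ c
T-injective {false} {false} _   = refl
T-injective {false} {true}  b⇔c = ⊥-elim (from b⇔c _)
T-injective {true}  {false} b⇔c = ⊥-elim (to b⇔c _)
T-injective {true}  {true}  _   = refl

OrbitMinimal : ∀ {n} → (Word n → Word n) → Word n → Set
OrbitMinimal s u = ∀ k → val u ≤ val (iter s k u)

isRep⇔OrbitMinimal : ∀ {n} {s : Word n → Word n} → Periodic s (2 ^ n) →
  ∀ u → T (isRep s u) ⇔ OrbitMinimal s u
isRep⇔OrbitMinimal {n} {s} per u = mk⇔ minimal (λ min → T-all⁺ _ (map⁺ (applyUpTo⁺₂ id (2 ^ n) (≤⇒≤ᵇ ∘ min))))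
  where
  instance _ = m^n≢0 2 n
  minimal : T (isRep s u) → OrbitMinimal s u
  minimal t k = subst (λ v → val u ≤ val v) (iter-%-period per k u)
    (≤ᵇ⇒≤ _ _ (applyUpTo⁻ id (2 ^ n) (map⁻ (T-all⁻ _ (orbit s u) t)) (m%n<n k (2 ^ n))))

isRep-cong : ∀ {m n} {s : Word m → Word m} {t : Word n → Word n} → Periodic s (2 ^ m) → Periodic t (2 ^ n) →
  ∀ {u v} → OrbitMinimal s u ⇔ OrbitMinimal t v → isRep s u ≡ isRep t v
isRep-cong pers pert {u} {v} su⇔tv = T-injective (mk⇔
  (from (isRep⇔OrbitMinimal pert v) ∘ to su⇔tv ∘ to (isRep⇔OrbitMinimal pers u))
  (from (isRep⇔OrbitMinimal pers u) ∘ from su⇔tv ∘ to (isRep⇔OrbitMinimal pert v)))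

minimalA-1 : ∀ {n} (w : Word n) → OrbitMinimal actA (true ∷ w)
minimalA-1 w k rewrite iterA-1 k w = ≤-refl

minimalA-0 : ∀ {n} (w : Word n) → OrbitMinimal actA (false ∷ w) ⇔ OrbitMinimal actB w
minimalA-0 w = mk⇔
  (λ min k → *-cancelˡ-≤ 2 (subst (λ v → val (false ∷ w) ≤ val v) (iterA-0 k w) (min k)))
  (λ min k → subst (λ v → val (false ∷ w) ≤ val v) (sym (iterA-0 k w)) (*-monoʳ-≤ 2 (min k)))

¬minimalB-1 : ∀ {n} (w : Word n) → ¬ OrbitMinimal actB (true ∷ w)
¬minimalB-1 w min = <-irrefl refl (min 1)

even-or-odd : ∀ k → ∃[ j ] k ≡ j + j ⊎ ∃[ j ] k ≡ suc (j + j)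
even-or-odd zero = inj₁ (0 , refl)
even-or-odd (suc k) with even-or-odd k
... | inj₁ (j , refl) = inj₂ (j , refl)
... | inj₂ (j , refl) = inj₁ (suc j , cong suc (sym (+-suc j j)))

minimalB-0 : ∀ {n} (w : Word n) → OrbitMinimal actB (false ∷ w) ⇔ OrbitMinimal actA w
minimalB-0 w = mk⇔
  (λ min k → *-cancelˡ-≤ 2 (subst (λ v → val (false ∷ w) ≤ val v) (iterB-even k false w) (min (k + k))))
  minimal
  where
  minimal : OrbitMinimal actA w → OrbitMinimal actB (false ∷ w)
  minimal min k with even-or-odd k
  ... | inj₁ (j , refl) rewrite iterB-even j false w = *-monoʳ-≤ 2 (min j)
  ... | inj₂ (j , refl) rewrite iterB-odd j w = m≤n⇒m≤1+n (*-monoʳ-≤ 2 (min (suc j)))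

isRepA-1 : ∀ {n} (w : Word n) → isRep actA (true ∷ w) ≡ true
isRepA-1 {n} w = to Bool.T-≡ (from (isRep⇔OrbitMinimal (actA-period (suc n)) _) (minimalA-1 w))

isRepA-0 : ∀ {n} (w : Word n) → isRep actA (false ∷ w) ≡ isRep actB w
isRepA-0 {n} w = isRep-cong (actA-period (suc n)) (actB-period n) (minimalA-0 w)

isRepB-1 : ∀ {n} (w : Word n) → isRep actB (true ∷ w) ≡ false
isRepB-1 {n} w = T-injective (mk⇔ (¬minimalB-1 w ∘ to (isRep⇔OrbitMinimal (actB-period (suc n)) _)) λ ())

isRepB-0 : ∀ {n} (w : Word n) → isRep actB (false ∷ w) ≡ isRep actA w
isRepB-0 {n} w = isRep-cong (actB-period (suc n)) (actA-period n) (minimalB-0 w)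

-- All orbits, fixed points included.
orbitsA orbitsB : ℕ → ℕ
orbitsA n = count (isRep actA) (allWords n)
orbitsB n = count (isRep actB) (allWords n)

orbitsA-suc : ∀ n → orbitsA (suc n) ≡ orbitsB n + 2 ^ n
orbitsA-suc n = trans (count-allWords-suc n (isRep actA))
  (cong₂ _+_ (count-cong isRepA-0 (allWords n)) (trans (count-true isRepA-1 (allWords n)) (length-allWords n)))

orbitsB-suc : ∀ n → orbitsB (suc n) ≡ orbitsA n
orbitsB-suc n = trans (count-allWords-suc n (isRep actB))
  (trans (cong₂ _+_ (count-cong isRepB-0 (allWords n)) (count-false isRepB-1 (allWords n))) (+-identityʳ _))

orbitsA-suc-suc : ∀ n → orbitsA (suc (suc n)) ≡ orbitsA n + 2 ^ suc n
orbitsA-suc-suc n = trans (orbitsA-suc (suc n)) (cong (_+ 2 ^ suc n) (orbitsB-suc n))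

cyclesB≡orbitsA : ∀ n → cyclesB (suc n) ≡ orbitsA n
cyclesB≡orbitsA n = trans (count-cong (λ u → trans (cong (isRep actB u ∧_) (movedB u)) (∧-identityʳ _)) (allWords (suc n)))
  (orbitsB-suc n)

cyclesA≡orbitsA : ∀ n → cyclesA (suc (suc n)) ≡ orbitsA n
cyclesA≡orbitsA n = begin
  cyclesA (suc (suc n))                   ≡⟨ count-allWords-suc (suc n) _ ⟩
  count (cycleRep ∘ (false ∷_)) ws + count (cycleRep ∘ (true ∷_)) ws
                                          ≡⟨ cong₂ _+_ (count-cong cycleRep-0 ws) (count-false cycleRep-1 ws) ⟩
  orbitsB (suc n) + 0                     ≡⟨ +-identityʳ _ ⟩
  orbitsB (suc n)                         ≡⟨ orbitsB-suc n ⟩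
  orbitsA n                               ∎
  where
  open ≡-Reasoning
  ws = allWords (suc n)
  cycleRep : Word (suc (suc n)) → Bool
  cycleRep u = isRep actA u ∧ moved actA u
  cycleRep-0 : ∀ w → cycleRep (false ∷ w) ≡ isRep actB w
  cycleRep-0 w = trans (cong₂ _∧_ (isRepA-0 w) (movedA-0 w)) (∧-identityʳ _)
  cycleRep-1 : ∀ w → cycleRep (true ∷ w) ≡ false
  cycleRep-1 w = trans (cong (isRep actA (true ∷ w) ∧_) (movedA-1 w)) (∧-zeroʳ _)

edgesA : ∀ n → edgesLabeled (suc (suc n)) actA ≡ 2 ^ suc n
edgesA n = trans (count-allWords-suc (suc n) (moved actA))
  (trans (cong₂ _+_ (trans (count-true movedA-0 ws) (length-allWords (suc n))) (count-false movedA-1 ws)) (+-identityʳ _))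
  where ws = allWords (suc n)

edgesB : ∀ n → edgesLabeled (suc n) actB ≡ 2 ^ suc n
edgesB n = trans (count-true movedB (allWords (suc n))) (length-allWords (suc n))

orbitsA-closed : ∀ n → 3 * orbitsA n ≡ 2 ^ suc n + suc (n % 2)
orbitsA-closed zero          = refl
orbitsA-closed (suc zero)    = refl
orbitsA-closed (suc (suc n)) = begin
  3 * orbitsA (suc (suc n))                ≡⟨ cong (3 *_) (orbitsA-suc-suc n) ⟩
  3 * (orbitsA n + x)                      ≡⟨ *-distribˡ-+ 3 (orbitsA n) x ⟩
  3 * orbitsA n + 3 * x                    ≡⟨ cong (_+ 3 * x) (orbitsA-closed n) ⟩
  x + suc (n % 2) + 3 * x                  ≡⟨ regroup x (suc (n % 2)) ⟩
  2 * (2 * x) + suc (n % 2)                ∎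
  where
  open ≡-Reasoning
  x = 2 ^ suc n
  regroup : ∀ x c → x + c + 3 * x ≡ 2 * (2 * x) + c
  regroup = solve 2 (λ x c → x :+ c :+ con 3 :* x := con 2 :* (con 2 :* x) :+ c) refl

orbitsA-consecutive : ∀ n → orbitsA n + orbitsA (suc n) ≡ 2 ^ suc n + 1
orbitsA-consecutive zero    = refl
orbitsA-consecutive (suc n) = begin
  orbitsA (suc n) + orbitsA (suc (suc n))  ≡⟨ cong (orbitsA (suc n) +_) (orbitsA-suc-suc n) ⟩
  orbitsA (suc n) + (orbitsA n + x)        ≡⟨ regroup (orbitsA n) (orbitsA (suc n)) x ⟩
  orbitsA n + orbitsA (suc n) + x          ≡⟨ cong (_+ x) (orbitsA-consecutive n) ⟩
  x + 1 + x                                ≡⟨ double x ⟩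
  2 * x + 1                                ∎
  where
  open ≡-Reasoning
  x = 2 ^ suc n
  regroup : ∀ a b x → b + (a + x) ≡ a + b + x
  regroup = solve 3 (λ a b x → b :+ (a :+ x) := a :+ b :+ x) refl
  double : ∀ x → x + 1 + x ≡ 2 * x + 1
  double = solve 1 (λ x → x :+ con 1 :+ x := con 2 :* x :+ con 1) refl

odd⇒suc-even : ∀ n → n % 2 ≡ 1 → suc n % 2 ≡ 0
odd⇒suc-even (suc zero)    _ = refl
odd⇒suc-even (suc (suc n)) h = odd⇒suc-even n h

even⇒suc-odd : ∀ n → n % 2 ≡ 0 → suc n % 2 ≡ 1
even⇒suc-odd zero          _ = refl
even⇒suc-odd (suc (suc n)) h = even⇒suc-odd n h

cyclesA-closed : ∀ n → 3 * cyclesA (suc (suc n)) ≡ 2 ^ suc n + suc (n % 2)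
cyclesA-closed n = trans (cong (3 *_) (cyclesA≡orbitsA n)) (orbitsA-closed n)

cyclesB-closed : ∀ n → 3 * cyclesB (suc n) ≡ 2 ^ suc n + suc (n % 2)
cyclesB-closed n = trans (cong (3 *_) (cyclesB≡orbitsA n)) (orbitsA-closed n)

mainTheorem3 : (n : ℕ) → 4 ≤ n →
    (n % 2 ≡ 1 → 3 * cyclesA n ≡ 2 ^ (n ∸ 1) + 2 × 3 * cyclesB n ≡ 2 ^ n + 1) ×
    (n % 2 ≡ 0 → 3 * cyclesA n ≡ 2 ^ (n ∸ 1) + 1 × 3 * cyclesB n ≡ 2 ^ n + 2) ×
    totalCycles n ≡ 2 ^ (n ∸ 1) + 1 ×
    totalEdges n ≡ 3 * 2 ^ (n ∸ 1)
mainTheorem3 n@(suc (suc m)) (s≤s (s≤s _)) =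
  (λ odd → byParity odd (odd⇒suc-even m odd)) ,
  (λ even → byParity even (even⇒suc-odd m even)) ,
  trans (cong₂ _+_ (cyclesA≡orbitsA m) (cyclesB≡orbitsA (suc m))) (orbitsA-consecutive m) ,
  cong₂ _+_ (edgesA m) (edgesB (suc m))
  where
  byParity : ∀ {p q} → m % 2 ≡ p → suc m % 2 ≡ q →
    3 * cyclesA n ≡ 2 ^ suc m + suc p × 3 * cyclesB n ≡ 2 ^ n + suc q
  byParity refl refl = cyclesA-closed m , cyclesB-closed (suc m)
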